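{- Let $m$ be a deficient number and let $p$ be a prime dividing $m$ with $p^\alpha\,\|\,m$. Then $mp$ is a primitive abundant number if and only if $p\,\sigma(p^\alpha) < c(m)$ and, for each prime power $q^\beta\,\|\,m$ with $q\neq p$, $$p\,\sigma(p^\alpha) > \frac{\sigma(m)}{d(m)+\frac{2m}{\sigma(q^\beta)-1}}.$$
   Context: For $n\in\mathbb{N}$, $\sigma(n)=\sum_{d\mid n}d$. $n$ is deficient if $\sigma(n)<2n$, perfect if $\sigma(n)=2n$, abundant if $\sigma(n)>2n$, and non-deficient if perfect or abundant. The deficiency is $d(n)=2n-\sigma(n)$ and the center is $c(n)=\sigma(n)/d(n)$. A number is primitive non-deficient if it is non-deficient and all its proper divisors are deficient. A primitive abundant number is a primitive non-deficient number that is abundant. $q^\beta\,\|\,m$ means $q^\beta\mid m$ and $q^{\beta+1}\nmid m$. -}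

module Defs where

open import Data.Nat as ℕ using (ℕ; zero; suc; _+_; _*_; _<_; _>_; _≤_)
open import Data.Nat.Divisibility using (_∣_; _∣?_)
open import Data.List using (List; filter; upTo; map)
open import Data.Nat.ListAction using (sum)
open import Data.Integer as ℤ using (ℤ; +_; +[1+_]; -[1+_])
open import Data.Rational as ℚ using (ℚ; mkℚ; 0ℚ; _÷_)
open import Relation.Nullary using (¬_)

-- divisors of n: the d ∈ {1,…,n} with d ∣ n  (empty for n = 0)
divisors : ℕ → List ℕ
divisors n = filter (_∣? n) (map suc (upTo n))

σ : ℕ → ℕ
σ n = sum (divisors n)

Deficient : ℕ → Set
Deficient n = σ n < 2 * n

Perfect : ℕ → Set
Perfect n = σ n ≡ 2 * n
  where open import Relation.Binary.PropositionalEquality using (_≡_)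

Abundant : ℕ → Set
Abundant n = σ n > 2 * n

NonDeficient : ℕ → Set
NonDeficient n = σ n ≥ 2 * n
  where open import Data.Nat using (_≥_)

ProperDivisor : ℕ → ℕ → Set
ProperDivisor d n = d ∣ n × d < n
  where open import Data.Product using (_×_)

PrimitiveNonDeficient : ℕ → Set
PrimitiveNonDeficient n = NonDeficient n × (∀ d → ProperDivisor d n → Deficient d)
  where open import Data.Product using (_×_)

PrimitiveAbundant : ℕ → Set
PrimitiveAbundant n = PrimitiveNonDeficient n × Abundant n
  where open import Data.Product using (_×_)

_^_∥_ : ℕ → ℕ → ℕ → Set
q ^ β ∥ m = (q ℕ.^ β ∣ m) × ¬ (q ℕ.^ suc β ∣ m)
  where open import Data.Product using (_×_)

ℕ→ℚ : ℕ → ℚ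
ℕ→ℚ n = (+ n) ℚ./ 1

-- total division on ℚ (x / 0 := 0); only ever used with nonzero denominators
_÷?_ : ℚ → ℚ → ℚ
x ÷? mkℚ (+ zero) _ _ = 0ℚ
x ÷? y@(mkℚ +[1+ _ ] _ _) = x ÷ y
x ÷? y@(mkℚ -[1+ _ ] _ _) = x ÷ y

-- deficiency d(n) = 2n − σ(n), as a rational (may be negative in general)
deficiency : ℕ → ℚ
deficiency n = ℕ→ℚ (2 * n) ℚ.- ℕ→ℚ (σ n)

center : ℕ → ℚ
center n = ℕ→ℚ (σ n) ÷? deficiency n

-- Put A = p σ(p^α). Since σ is multiplicative and σ(p^(α+1)) = 1 + A, we get
-- σ(mp) σ(p^α) = σ(m) (1 + A), so mp is abundant iff 2mA < σ(m)(1 + A), which for deficient m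
-- says A < c(m). Every proper divisor of mp divides a cofactor mp/q with q prime, and divisors of
-- deficient numbers are deficient; mp/p = m is deficient, so mp is primitive iff mp/q is deficient
-- for every prime q ≠ p dividing m. If q^β ∥ m, then σ(mp/q) σ(q^β) = σ(mp) σ(q^(β-1)), and
-- clearing denominators turns the deficiency of mp/q into the stated lower bound on A.

module Submission where

open import Defs
open import Data.Nat using (ℕ; zero; suc; _+_; _*_; _∸_; _^_; _<_; _≤_; z≤n; z<s; NonZero; >-nonZero; nonTrivial⇒n>1)
open import Data.Nat.Properties
open import Algebra.Properties.CommutativeSemigroup +-commutativeSemigroup using () renaming (x∙yz≈y∙xz to x+[y+z]≡y+[x+z])
open import Algebra.Properties.CommutativeSemigroup *-commutativeSemigroup using () renaming (x∙yz≈y∙xz to x*[y*z]≡y*[x*z])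
open import Data.Nat.Divisibility
open import Data.Nat.Primality using (Prime; prime⇒nonZero; prime⇒nonTrivial; prime⇒irreducible; euclidsLemma)
open import Data.Nat.Coprimality using (Coprime; coprime-divisor)
open import Data.Nat.Primality.Factorisation using (factorise)
open import Data.Nat.ListAction using (sum; product)
open import Data.Nat.ListAction.Properties using (sum-++)
open import Data.Nat.Induction using (<-rec)
open import Data.Nat.Tactic.RingSolver using (solve-∀)
open import Data.List using (List; []; _∷_; _++_; map; filter; upTo)
open import Data.List.Membership.Propositional using (_∈_)
open import Data.List.Membership.Propositional.Properties
open import Data.List.Relation.Unary.Any using (here; there)
open import Data.List.Relation.Unary.All as All using (_∷_)
open import Data.List.Relation.Unary.AllPairs using (_∷_)
open import Data.List.Relation.Unary.Unique.Propositional using (Unique)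
import Data.List.Relation.Unary.Unique.Propositional.Properties as Unique
open import Data.List.Relation.Binary.Subset.Propositional using (_⊆_)
import Data.Integer as ℤ
import Data.Integer.Properties as ℤ
open import Data.Rational using (ℚ; mkℚ; toℚᵘ)
import Data.Rational as ℚ
import Data.Rational.Properties as ℚ
open import Data.Rational.Unnormalised as ℚᵘ using (mkℚᵘ; *≡*; *<*)
import Data.Rational.Unnormalised.Properties as ℚᵘ
open import Data.Product using (∃₂; ∃-syntax; _×_; _,_; proj₁; proj₂)
open import Data.Sum using (inj₁; inj₂)
open import Function.Bundles using (_⇔_; mk⇔; Equivalence)
open import Function.Properties.Equivalence using (⇔-setoid)
open import Level using (0ℓ)
open import Relation.Nullary using (¬_; Dec; yes; no; ¬?; contradiction)
open import Relation.Unary using (Decidable)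
open import Relation.Binary.PropositionalEquality

open Equivalence using (to; from)

sum-mono-⊆ : ∀ {xs ys : List ℕ} → Unique xs → xs ⊆ ys → sum xs ≤ sum ys
sum-mono-⊆ {[]} _ _ = z≤n
sum-mono-⊆ {x ∷ xs} {ys} (x∉xs ∷ xs!) xs⊆ys with ∈-∃++ (xs⊆ys (here refl))
... | ys₁ , ys₂ , refl = begin
  x + sum xs              ≤⟨ +-monoʳ-≤ x (sum-mono-⊆ xs! xs⊆ys₁ys₂) ⟩
  x + sum (ys₁ ++ ys₂)    ≡⟨ cong (x +_) (sum-++ ys₁ ys₂) ⟩
  x + (sum ys₁ + sum ys₂) ≡⟨ x+[y+z]≡y+[x+z] x (sum ys₁) (sum ys₂) ⟩
  sum ys₁ + (x + sum ys₂) ≡⟨ sum-++ ys₁ (x ∷ ys₂) ⟨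
  sum (ys₁ ++ x ∷ ys₂)    ∎
  where
  open ≤-Reasoning
  xs⊆ys₁ys₂ : xs ⊆ ys₁ ++ ys₂
  xs⊆ys₁ys₂ {y} y∈xs with ∈-++⁻ ys₁ (xs⊆ys (there y∈xs))
  ... | inj₁ y∈ys₁         = ∈-++⁺ˡ y∈ys₁
  ... | inj₂ (here refl)   = contradiction refl (All.lookup x∉xs y∈xs)
  ... | inj₂ (there y∈ys₂) = ∈-++⁺ʳ ys₁ y∈ys₂

sum-unique-cong : ∀ {xs ys : List ℕ} → Unique xs → Unique ys → xs ⊆ ys → ys ⊆ xs → sum xs ≡ sum ys
sum-unique-cong xs! ys! xs⊆ys ys⊆xs = ≤-antisym (sum-mono-⊆ xs! xs⊆ys) (sum-mono-⊆ ys! ys⊆xs)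

sum-map-* : ∀ k (xs : List ℕ) → sum (map (k *_) xs) ≡ k * sum xs
sum-map-* k []       = sym (*-zeroʳ k)
sum-map-* k (x ∷ xs) = trans (cong (k * x +_) (sum-map-* k xs)) (sym (*-distribˡ-+ k x (sum xs)))

divisors-unique : ∀ n → Unique (divisors n)
divisors-unique n = Unique.filter⁺ (_∣? n) (Unique.map⁺ suc-injective (Unique.upTo⁺ n))

∈-divisors⁺ : ∀ {d n} → 0 < n → d ∣ n → d ∈ divisors n
∈-divisors⁺ {zero}      0<n 0∣n = contradiction (sym (0∣⇒≡0 0∣n)) (<⇒≢ 0<n)
∈-divisors⁺ {suc d} {n} 0<n d∣n =
  ∈-filter⁺ (_∣? n) (∈-map⁺ suc (∈-upTo⁺ (∣⇒≤ {{>-nonZero 0<n}} d∣n))) d∣n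

∈-divisors⁻ : ∀ {d n} → d ∈ divisors n → d ∣ n × 0 < n
∈-divisors⁻ {d} {n} d∈ with ∈-filter⁻ (_∣? n) {xs = map suc (upTo n)} d∈
... | d∈' , d∣n with ∈-map⁻ suc d∈'
... | _ , i∈ , refl = d∣n , ≤-<-trans z≤n (∈-upTo⁻ i∈)

*-σ≤σ-* : ∀ k d → k * σ d ≤ σ (k * d)
*-σ≤σ-* zero    d = z≤n
*-σ≤σ-* k@(suc _) d = subst (_≤ σ (k * d)) (sum-map-* k (divisors d))
  (sum-mono-⊆ (Unique.map⁺ (*-cancelˡ-≡ _ _ k) (divisors-unique d)) k*divisors⊆)
  where
  k*divisors⊆ : map (k *_) (divisors d) ⊆ divisors (k * d)
  k*divisors⊆ i with ∈-map⁻ (k *_) i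
  ... | e , e∈ , refl with ∈-divisors⁻ {n = d} e∈
  ... | e∣d , 0<d = ∈-divisors⁺ {n = k * d} (<-≤-trans 0<d (m≤n*m _ k)) (*-monoʳ-∣ k e∣d)

deficient⇒pos : ∀ {n} → Deficient n → 0 < n
deficient⇒pos {zero}  ()
deficient⇒pos {suc n} _ = z<s

deficient-∣ : ∀ {d n} → d ∣ n → Deficient n → Deficient d
deficient-∣ {d} (divides k refl) n-def = *-cancelˡ-< k (σ d) (2 * d) (begin-strict
  k * σ d     ≤⟨ *-σ≤σ-* k d ⟩
  σ (k * d)   <⟨ n-def ⟩
  2 * (k * d) ≡⟨ x*[y*z]≡y*[x*z] 2 k d ⟩
  k * (2 * d) ∎)
  where open ≤-Reasoning

prime>1 : ∀ {r} → Prime r → 1 < r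
prime>1 {r} r-prime = nonTrivial⇒n>1 r {{prime⇒nonTrivial r-prime}}

prime∤1 : ∀ {r} → Prime r → ¬ r ∣ 1
prime∤1 r-prime r∣1 = <⇒≢ (prime>1 r-prime) (sym (∣1⇒≡1 r∣1))

prime∤prime : ∀ {q p} → Prime q → Prime p → q ≢ p → ¬ q ∣ p
prime∤prime q-prime p-prime q≢p q∣p with prime⇒irreducible p-prime q∣p
... | inj₁ refl = prime∤1 q-prime ∣-refl
... | inj₂ q≡p  = q≢p q≡p

prime∣m*p⇒∣m : ∀ {q p m} → Prime q → Prime p → q ≢ p → q ∣ m * p → q ∣ m
prime∣m*p⇒∣m {q} {p} {m} q-prime p-prime q≢p q∣mp with euclidsLemma m p q-prime q∣mp
... | inj₁ q∣m = q∣m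
... | inj₂ q∣p = contradiction q∣p (prime∤prime q-prime p-prime q≢p)

∣r*n⇒∣n : ∀ {r x n} → Prime r → ¬ r ∣ x → x ∣ r * n → x ∣ n
∣r*n⇒∣n {r} {x} r-prime r∤x = coprime-divisor x⊥r
  where
  x⊥r : Coprime x r
  x⊥r (i∣x , i∣r) with prime⇒irreducible r-prime i∣r
  ... | inj₁ i≡1 = i≡1
  ... | inj₂ refl = contradiction i∣x r∤x

_∤?_ : ∀ r → Decidable (λ d → ¬ r ∣ d)
r ∤? d = ¬? (r ∣? d)

σ⊥ : ℕ → ℕ → ℕ
σ⊥ r n = sum (filter (r ∤?_) (divisors n))

σ-*prime : ∀ {r n} → Prime r → 0 < n → σ (r * n) ≡ r * σ n + σ⊥ r n
σ-*prime {r} {n} r-prime 0<n = begin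
  σ (r * n)                ≡⟨ sum-unique-cong (divisors-unique (r * n)) split! ⊆split split⊆ ⟩
  sum (multiples ++ others) ≡⟨ sum-++ multiples others ⟩
  sum multiples + σ⊥ r n    ≡⟨ cong (_+ σ⊥ r n) (sum-map-* r (divisors n)) ⟩
  r * σ n + σ⊥ r n          ∎
  where
  open ≡-Reasoning
  instance
    r≢0 : NonZero r
    r≢0 = prime⇒nonZero r-prime
  multiples others : List ℕ
  multiples = map (r *_) (divisors n)
  others    = filter (r ∤?_) (divisors n)
  0<rn : 0 < r * n
  0<rn = <-≤-trans 0<n (m≤n*m n r)
  split! : Unique (multiples ++ others)
  split! = Unique.++⁺ (Unique.map⁺ (*-cancelˡ-≡ _ _ r) (divisors-unique n))
                      (Unique.filter⁺ (r ∤?_) (divisors-unique n)) disjoint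
    where
    disjoint : ∀ {v} → ¬ (v ∈ multiples × v ∈ others)
    disjoint (v∈mult , v∈oth) with ∈-map⁻ (r *_) v∈mult | ∈-filter⁻ (r ∤?_) {xs = divisors n} v∈oth
    ... | y , _ , refl | _ , r∤ry = r∤ry (m∣m*n y)
  ⊆split : divisors (r * n) ⊆ multiples ++ others
  ⊆split {x} x∈ with proj₁ (∈-divisors⁻ {n = r * n} x∈) | r ∣? x
  ... | x∣rn | yes (divides y refl) = ∈-++⁺ˡ (subst (_∈ multiples) (*-comm r y)
        (∈-map⁺ (r *_) (∈-divisors⁺ 0<n (*-cancelˡ-∣ r (subst (_∣ r * n) (*-comm y r) x∣rn)))))
  ... | x∣rn | no r∤x = ∈-++⁺ʳ multiples (∈-filter⁺ (r ∤?_) (∈-divisors⁺ 0<n (∣r*n⇒∣n r-prime r∤x x∣rn)) r∤x)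
  split⊆ : multiples ++ others ⊆ divisors (r * n)
  split⊆ x∈ with ∈-++⁻ multiples x∈
  ... | inj₁ x∈mult with ∈-map⁻ (r *_) x∈mult
  ...   | y , y∈ , refl = ∈-divisors⁺ 0<rn (*-monoʳ-∣ r (proj₁ (∈-divisors⁻ y∈)))
  split⊆ x∈ | inj₂ x∈oth = ∈-divisors⁺ 0<rn (∣n⇒∣m*n r (proj₁ (∈-divisors⁻ (proj₁ (∈-filter⁻ (r ∤?_) {xs = divisors n} x∈oth)))))

σ⊥-*prime : ∀ {r n} → Prime r → 0 < n → σ⊥ r (r * n) ≡ σ⊥ r n
σ⊥-*prime {r} {n} r-prime 0<n = sum-unique-cong
  (Unique.filter⁺ (r ∤?_) (divisors-unique (r * n))) (Unique.filter⁺ (r ∤?_) (divisors-unique n)) rn⊆n n⊆rn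
  where
  instance
    r≢0 : NonZero r
    r≢0 = prime⇒nonZero r-prime
  rn⊆n : filter (r ∤?_) (divisors (r * n)) ⊆ filter (r ∤?_) (divisors n)
  rn⊆n i with ∈-filter⁻ (r ∤?_) {xs = divisors (r * n)} i
  ... | x∈ , r∤x = ∈-filter⁺ (r ∤?_) (∈-divisors⁺ 0<n (∣r*n⇒∣n r-prime r∤x (proj₁ (∈-divisors⁻ x∈)))) r∤x
  n⊆rn : filter (r ∤?_) (divisors n) ⊆ filter (r ∤?_) (divisors (r * n))
  n⊆rn i with ∈-filter⁻ (r ∤?_) {xs = divisors n} i
  ... | x∈ , r∤x = ∈-filter⁺ (r ∤?_) (∈-divisors⁺ (<-≤-trans 0<n (m≤n*m n r)) (∣n⇒∣m*n r (proj₁ (∈-divisors⁻ x∈)))) r∤x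

σ⊥-coprime : ∀ {r w} → ¬ r ∣ w → σ⊥ r w ≡ σ w
σ⊥-coprime {r} {w} r∤w = sum-unique-cong (Unique.filter⁺ (r ∤?_) (divisors-unique w)) (divisors-unique w) filter⊆ ⊆filter
  where
  filter⊆ : filter (r ∤?_) (divisors w) ⊆ divisors w
  filter⊆ i = proj₁ (∈-filter⁻ (r ∤?_) {xs = divisors w} i)
  ⊆filter : divisors w ⊆ filter (r ∤?_) (divisors w)
  ⊆filter i = ∈-filter⁺ (r ∤?_) i (λ r∣x → r∤w (∣-trans r∣x (proj₁ (∈-divisors⁻ i))))

∤⇒pos : ∀ {r w} → ¬ r ∣ w → 0 < w
∤⇒pos {r} {zero}  r∤0 = contradiction (r ∣0) r∤0
∤⇒pos {r} {suc w} _   = z<s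

^*-pos : ∀ {r w} → Prime r → ¬ r ∣ w → ∀ j → 0 < r ^ j * w
^*-pos {r} r-prime r∤w j = <-≤-trans (∤⇒pos r∤w) (m≤n*m _ (r ^ j) {{m^n≢0 r j {{prime⇒nonZero r-prime}}}})

σ⊥-^* : ∀ {r w} → Prime r → ¬ r ∣ w → ∀ j → σ⊥ r (r ^ j * w) ≡ σ w
σ⊥-^* {r} {w} r-prime r∤w zero    = trans (cong (σ⊥ r) (+-identityʳ w)) (σ⊥-coprime r∤w)
σ⊥-^* {r} {w} r-prime r∤w (suc j) = begin
  σ⊥ r (r * r ^ j * w)   ≡⟨ cong (σ⊥ r) (*-assoc r (r ^ j) w) ⟩
  σ⊥ r (r * (r ^ j * w)) ≡⟨ σ⊥-*prime r-prime (^*-pos r-prime r∤w j) ⟩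
  σ⊥ r (r ^ j * w)       ≡⟨ σ⊥-^* r-prime r∤w j ⟩
  σ w                    ∎
  where open ≡-Reasoning

σ-^suc-* : ∀ {r w} → Prime r → ¬ r ∣ w → ∀ j → σ (r ^ suc j * w) ≡ r * σ (r ^ j * w) + σ w
σ-^suc-* {r} {w} r-prime r∤w j = begin
  σ (r * r ^ j * w)                  ≡⟨ cong σ (*-assoc r (r ^ j) w) ⟩
  σ (r * (r ^ j * w))                ≡⟨ σ-*prime r-prime (^*-pos r-prime r∤w j) ⟩
  r * σ (r ^ j * w) + σ⊥ r (r ^ j * w) ≡⟨ cong (r * σ (r ^ j * w) +_) (σ⊥-^* r-prime r∤w j) ⟩
  r * σ (r ^ j * w) + σ w            ∎
  where open ≡-Reasoning

σ-^suc : ∀ {r} → Prime r → ∀ j → σ (r ^ suc j) ≡ 1 + r * σ (r ^ j)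
σ-^suc {r} r-prime j = begin
  σ (r ^ suc j)                ≡⟨ cong σ (*-identityʳ (r ^ suc j)) ⟨
  σ (r ^ suc j * 1)            ≡⟨ σ-^suc-* r-prime (prime∤1 r-prime) j ⟩
  r * σ (r ^ j * 1) + 1        ≡⟨ cong (λ x → r * σ x + 1) (*-identityʳ (r ^ j)) ⟩
  r * σ (r ^ j) + 1            ≡⟨ +-comm _ 1 ⟩
  1 + r * σ (r ^ j)            ∎
  where open ≡-Reasoning

σ-^-* : ∀ {r w} → Prime r → ¬ r ∣ w → ∀ j → σ (r ^ j * w) ≡ σ (r ^ j) * σ w
σ-^-* {r} {w} r-prime r∤w zero    = trans (cong σ (+-identityʳ w)) (sym (+-identityʳ (σ w)))
σ-^-* {r} {w} r-prime r∤w (suc j) = begin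
  σ (r ^ suc j * w)               ≡⟨ σ-^suc-* r-prime r∤w j ⟩
  r * σ (r ^ j * w) + σ w         ≡⟨ cong (λ x → r * x + σ w) (σ-^-* r-prime r∤w j) ⟩
  r * (σ (r ^ j) * σ w) + σ w     ≡⟨ factor r (σ (r ^ j)) (σ w) ⟩
  (1 + r * σ (r ^ j)) * σ w       ≡⟨ cong (_* σ w) (σ-^suc r-prime j) ⟨
  σ (r ^ suc j) * σ w             ∎
  where
  open ≡-Reasoning
  factor : ∀ a b c → a * (b * c) + c ≡ (1 + a * b) * c
  factor = solve-∀

σ-^suc-ratio : ∀ {r w} → Prime r → ¬ r ∣ w → ∀ j →
  σ (r ^ suc j * w) * σ (r ^ j) ≡ σ (r ^ j * w) * σ (r ^ suc j)
σ-^suc-ratio {r} {w} r-prime r∤w j = begin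
  σ (r ^ suc j * w) * σ (r ^ j)       ≡⟨ cong (_* σ (r ^ j)) (σ-^-* r-prime r∤w (suc j)) ⟩
  σ (r ^ suc j) * σ w * σ (r ^ j)     ≡⟨ swap (σ (r ^ suc j)) (σ w) (σ (r ^ j)) ⟩
  σ (r ^ j) * σ w * σ (r ^ suc j)     ≡⟨ cong (_* σ (r ^ suc j)) (σ-^-* r-prime r∤w j) ⟨
  σ (r ^ j * w) * σ (r ^ suc j)       ∎
  where
  open ≡-Reasoning
  swap : ∀ a b c → a * b * c ≡ c * b * a
  swap = solve-∀

σ-^-pos : ∀ {r} → Prime r → ∀ j → 0 < σ (r ^ j)
σ-^-pos r-prime zero    = z<s
σ-^-pos r-prime (suc j) = subst (0 <_) (sym (σ-^suc r-prime j)) z<s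

∥⇒cofactor : ∀ {q β m} → q ^ β ∥ m → ∃[ w ] m ≡ q ^ β * w × ¬ q ∣ w
∥⇒cofactor {q} {β} (divides w m≡w*qᵝ , qᵝ⁺¹∤m) = w , trans m≡w*qᵝ (*-comm w (q ^ β)) , λ where
  (divides c refl) → qᵝ⁺¹∤m (divides c (trans m≡w*qᵝ (*-assoc c q (q ^ β))))

∣⇒¬^0∥ : ∀ {q m} → q ∣ m → ¬ q ^ 0 ∥ m
∣⇒¬^0∥ {q} q∣m (_ , q¹∤m) = q¹∤m (subst (_∣ _) (sym (*-identityʳ q)) q∣m)

^∥⇒^suc∥-* : ∀ {q β k} .{{_ : NonZero q}} → q ^ β ∥ k → q ^ suc β ∥ (k * q)
^∥⇒^suc∥-* {q} {β} {k} (qᵝ∣k , qᵝ⁺¹∤k) =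
  subst (_∣ k * q) (*-comm (q ^ β) q) (*-monoˡ-∣ q qᵝ∣k) ,
  λ qᵝ⁺²∣kq → qᵝ⁺¹∤k (*-cancelʳ-∣ q (subst (_∣ k * q) (*-comm q (q ^ suc β)) qᵝ⁺²∣kq))

∥-exists : ∀ {q} → Prime q → ∀ m → 0 < m → ∃[ β ] q ^ β ∥ m
∥-exists {q} q-prime = <-rec (λ m → 0 < m → ∃[ β ] q ^ β ∥ m) step
  where
  instance
    q≢0 : NonZero q
    q≢0 = prime⇒nonZero q-prime
  step : ∀ m → (∀ {k} → k < m → 0 < k → ∃[ β ] q ^ β ∥ k) → 0 < m → ∃[ β ] q ^ β ∥ m
  step m rec 0<m with q ∣? m
  ... | no q∤m = 0 , 1∣ m , λ q¹∣m → q∤m (subst (_∣ m) (*-identityʳ q) q¹∣m)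
  ... | yes (divides k@(suc _) refl) with rec (m<m*n k q (prime>1 q-prime)) z<s
  ...   | β , qᵝ∥k = suc β , ^∥⇒^suc∥-* {β = β} qᵝ∥k

∣⇒∃^suc∥ : ∀ {q m} → Prime q → 0 < m → q ∣ m → ∃[ β ] q ^ suc β ∥ m
∣⇒∃^suc∥ {q} {m} q-prime 0<m q∣m with ∥-exists q-prime m 0<m
... | zero  , q⁰∥m = contradiction q⁰∥m (∣⇒¬^0∥ q∣m)
... | suc β , qᵝ⁺¹∥m = β , qᵝ⁺¹∥m

∃-prime-∣ : ∀ {k} → 1 < k → ∃[ q ] Prime q × q ∣ k
∃-prime-∣ {k@(suc _)} 1<k with factorise k
... | record { factors = [] ; isFactorisation = k≡1 } = contradiction k≡1 (>⇒≢ 1<k)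
... | record { factors = q ∷ qs ; isFactorisation = k≡q*qs ; factorsPrime = q-prime ∷ _ } =
  q , q-prime , divides (product qs) (trans k≡q*qs (*-comm q (product qs)))

properDivisor⇒∣-prime-cofactor : ∀ {d n} → ProperDivisor d n → ∃₂ λ q c → Prime q × q * c ≡ n × d ∣ c
properDivisor⇒∣-prime-cofactor {d} (divides k refl , d<kd)
  with ∃-prime-∣ (*-cancelʳ-< d 1 k (subst (_< k * d) (sym (*-identityˡ d)) d<kd))
... | q , q-prime , divides c refl = q , c * d , q-prime , q*[c*d]≡c*q*d , divides c refl
  where
  q*[c*d]≡c*q*d : q * (c * d) ≡ c * q * d
  q*[c*d]≡c*q*d = trans (sym (*-assoc q c d)) (cong (_* d) (*-comm q c))

cofactor-properDivisor : ∀ {q c n} → Prime q → 0 < n → q * c ≡ n → ProperDivisor c n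
cofactor-properDivisor {q} {zero}      _       0<q*0 refl = contradiction (*-zeroʳ q) (>⇒≢ 0<q*0)
cofactor-properDivisor {q} {c@(suc _)} q-prime _     refl =
  divides q refl , subst (c <_) (*-comm c q) (m<m*n c q (prime>1 q-prime))

-- Rational expressions are evaluated to the form u / (1 + k) with u, k : ℕ, which turns the
-- rational comparisons of the theorem into comparisons of natural numbers.
infix 4 _≃_/1+_

_≃_/1+_ : ℚ → ℕ → ℕ → Set
x ≃ u /1+ k = toℚᵘ x ℚᵘ.≃ mkℚᵘ (ℤ.+ u) k

mkℚᵘ-≃ : ∀ {u k v j} → u * suc j ≡ v * suc k → mkℚᵘ (ℤ.+ u) k ℚᵘ.≃ mkℚᵘ (ℤ.+ v) j
mkℚᵘ-≃ {u} {k} {v} {j} eq = *≡* (begin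
  ℤ.+ u ℤ.* ℤ.+ suc j ≡⟨ ℤ.pos-* u (suc j) ⟨
  ℤ.+ (u * suc j)     ≡⟨ cong ℤ.+_ eq ⟩
  ℤ.+ (v * suc k)     ≡⟨ ℤ.pos-* v (suc k) ⟩
  ℤ.+ v ℤ.* ℤ.+ suc k ∎)
  where open ≡-Reasoning

mkℚᵘ-<⇔ : ∀ {u k v j} → mkℚᵘ (ℤ.+ u) k ℚᵘ.< mkℚᵘ (ℤ.+ v) j ⇔ u * suc j < v * suc k
mkℚᵘ-<⇔ {u} {k} {v} {j} = mk⇔
  (λ { (*<* lt) → ℤ.drop‿+<+ (subst₂ ℤ._<_ (sym (ℤ.pos-* u (suc j))) (sym (ℤ.pos-* v (suc k))) lt) })
  (λ lt → *<* (subst₂ ℤ._<_ (ℤ.pos-* u (suc j)) (ℤ.pos-* v (suc k)) (ℤ.+<+ lt)))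

ℕ→ℚ-≃ : ∀ n → ℕ→ℚ n ≃ n /1+ 0
ℕ→ℚ-≃ n = ℚ.toℚᵘ-fromℚᵘ (mkℚᵘ (ℤ.+ n) 0)

≃-<⇔ : ∀ {x y u k v j} → x ≃ u /1+ k → y ≃ v /1+ j → x ℚ.< y ⇔ u * suc j < v * suc k
≃-<⇔ x≃ y≃ = mk⇔
  (λ x<y → to mkℚᵘ-<⇔ (ℚᵘ.<-respˡ-≃ x≃ (ℚᵘ.<-respʳ-≃ y≃ (ℚ.toℚᵘ-mono-< x<y))))
  (λ lt → ℚ.toℚᵘ-cancel-< (ℚᵘ.<-respˡ-≃ (ℚᵘ.≃-sym x≃) (ℚᵘ.<-respʳ-≃ (ℚᵘ.≃-sym y≃) (from mkℚᵘ-<⇔ lt))))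

≃-injective : ∀ {x y u k v j} → x ≃ u /1+ k → y ≃ v /1+ j → u * suc j ≡ v * suc k → x ≡ y
≃-injective x≃ y≃ eq = ℚ.toℚᵘ-injective (ℚᵘ.≃-trans x≃ (ℚᵘ.≃-trans (mkℚᵘ-≃ eq) (ℚᵘ.≃-sym y≃)))

≃-+ : ∀ {x y u k v j} → x ≃ u /1+ k → y ≃ v /1+ j →
  x ℚ.+ y ≃ u * suc j + v * suc k /1+ (j + k * suc j)
≃-+ {x} {y} {u} {k} {v} {j} x≃ y≃ = ℚᵘ.≃-trans (ℚ.toℚᵘ-homo-+ x y)
  (ℚᵘ.≃-trans (ℚᵘ.+-cong x≃ y≃) (ℚᵘ.≃-reflexive (cong (λ z → mkℚᵘ z (j + k * suc j)) numerator)))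
  where
  numerator : ℤ.+ u ℤ.* ℤ.+ suc j ℤ.+ ℤ.+ v ℤ.* ℤ.+ suc k ≡ ℤ.+ (u * suc j + v * suc k)
  numerator = trans (cong₂ ℤ._+_ (sym (ℤ.pos-* u (suc j))) (sym (ℤ.pos-* v (suc k))))
                    (sym (ℤ.pos-+ (u * suc j) (v * suc k)))

≃-÷? : ∀ {x y u k v j} → x ≃ u /1+ k → y ≃ suc v /1+ j → x ÷? y ≃ u * suc j /1+ (v + k * suc v)
≃-÷? {y = mkℚ (ℤ.+ zero)  _ _} _ (*≡* ())
≃-÷? {y = mkℚ ℤ.-[1+ _ ] _ _} _ (*≡* ())
≃-÷? {x} {y@(mkℚ ℤ.+[1+ n ] d _)} {u} {k} {v} {j} x≃ (*≡* y≃) =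
  ℚᵘ.≃-trans (ℚ.toℚᵘ-homo-* x (ℚ.1/ y))
  (ℚᵘ.≃-trans (ℚᵘ.*-cong x≃ (ℚᵘ.≃-refl {mkℚᵘ ℤ.+[1+ d ] n}))
  (ℚᵘ.≃-trans (ℚᵘ.≃-reflexive (cong (λ z → mkℚᵘ z (n + k * suc n)) (sym (ℤ.pos-* u (suc d)))))
  (mkℚᵘ-≃ cross)))
  where
  n+1*j+1≡v+1*d+1 : suc n * suc j ≡ suc v * suc d
  n+1*j+1≡v+1*d+1 = ℤ.+-injective (trans (ℤ.pos-* (suc n) (suc j)) (trans y≃ (sym (ℤ.pos-* (suc v) (suc d)))))
  cross : u * suc d * (suc k * suc v) ≡ u * suc j * (suc k * suc n)
  cross = begin
    u * suc d * (suc k * suc v)   ≡⟨ regroup u (suc d) (suc k) (suc v) ⟩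
    (u * suc k) * (suc v * suc d) ≡⟨ cong ((u * suc k) *_) n+1*j+1≡v+1*d+1 ⟨
    (u * suc k) * (suc n * suc j) ≡⟨ regroup′ u (suc k) (suc n) (suc j) ⟩
    u * suc j * (suc k * suc n)   ∎
    where
    open ≡-Reasoning
    regroup : ∀ a b c e → a * b * (c * e) ≡ a * c * (e * b)
    regroup = solve-∀
    regroup′ : ∀ a b c e → a * b * (c * e) ≡ a * e * (b * c)
    regroup′ = solve-∀

ℕ→ℚ-+ : ∀ a b → ℕ→ℚ (a + b) ≡ ℕ→ℚ a ℚ.+ ℕ→ℚ b
ℕ→ℚ-+ a b = ≃-injective (ℕ→ℚ-≃ (a + b)) (≃-+ (ℕ→ℚ-≃ a) (ℕ→ℚ-≃ b)) (pad a b)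
  where
  pad : ∀ a b → (a + b) * 1 ≡ (a * 1 + b * 1) * 1
  pad = solve-∀

deficiency-≃ : ∀ {n k} → 2 * n ≡ k + σ n → deficiency n ≃ k /1+ 0
deficiency-≃ {n} {k} 2n≡k+σn = subst (λ x → x ≃ k /1+ 0) (sym deficiency≡k) (ℕ→ℚ-≃ k)
  where
  open ≡-Reasoning
  s : ℚ
  s = ℕ→ℚ (σ n)
  deficiency≡k : deficiency n ≡ ℕ→ℚ k
  deficiency≡k = begin
    ℕ→ℚ (2 * n) ℚ.- s     ≡⟨ cong (λ x → ℕ→ℚ x ℚ.- s) 2n≡k+σn ⟩
    ℕ→ℚ (k + σ n) ℚ.- s   ≡⟨ cong (ℚ._- s) (ℕ→ℚ-+ k (σ n)) ⟩
    ℕ→ℚ k ℚ.+ s ℚ.- s     ≡⟨ ℚ.+-assoc (ℕ→ℚ k) s (ℚ.- s) ⟩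
    ℕ→ℚ k ℚ.+ (s ℚ.- s)   ≡⟨ cong (ℕ→ℚ k ℚ.+_) (ℚ.+-inverseʳ s) ⟩
    ℕ→ℚ k ℚ.+ ℚ.0ℚ        ≡⟨ ℚ.+-identityʳ (ℕ→ℚ k) ⟩
    ℕ→ℚ k                 ∎

deficient⇒gap : ∀ {n} → Deficient n → ∃[ k ] 2 * n ≡ suc k + σ n
deficient⇒gap {n} σn<2n = k , sym (trans (sym (+-suc k (σ n))) (m∸n+n≡m σn<2n))
  where
  k : ℕ
  k = 2 * n ∸ suc (σ n)

<⇔+-<+ : ∀ c {a b} → a < b ⇔ a + c < b + c
<⇔+-<+ c {a} {b} = mk⇔ (+-monoˡ-< c) (+-cancelʳ-< c a b)

<⇔<-scaled : ∀ c .{{_ : NonZero c}} {a b a′ b′} → a * c ≡ a′ → b * c ≡ b′ → a < b ⇔ a′ < b′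
<⇔<-scaled c {a} {b} refl refl = mk⇔ (*-monoˡ-< c) (*-cancelʳ-< c a b)

center-bound⇔ : ∀ n a → Deficient n → ℕ→ℚ a ℚ.< center n ⇔ 2 * n * a < σ n * (1 + a)
center-bound⇔ n a n-def = begin
  ℕ→ℚ a ℚ.< center n                     ≈⟨ ≃-<⇔ (ℕ→ℚ-≃ a) center≃ ⟩
  a * suc k < σ n * 1                    ≡⟨ cong (a * suc k <_) (*-identityʳ (σ n)) ⟩
  a * suc k < σ n                        ≈⟨ <⇔+-<+ (a * σ n) ⟩
  a * suc k + a * σ n < σ n + a * σ n    ≡⟨ cong₂ _<_ lhs rhs ⟩
  2 * n * a < σ n * (1 + a)              ∎
  where
  open import Relation.Binary.Reasoning.Setoid (⇔-setoid 0ℓ)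
  k : ℕ
  k = proj₁ (deficient⇒gap {n} n-def)
  2n≡ : 2 * n ≡ suc k + σ n
  2n≡ = proj₂ (deficient⇒gap {n} n-def)
  center≃ : center n ≃ σ n /1+ k
  center≃ = subst₂ (_≃_/1+_ (center n)) (*-identityʳ (σ n)) (+-identityʳ k)
    (≃-÷? (ℕ→ℚ-≃ (σ n)) (deficiency-≃ {n} 2n≡))
  lhs : a * suc k + a * σ n ≡ 2 * n * a
  lhs = trans (sym (*-distribˡ-+ a (suc k) (σ n))) (trans (cong (a *_) (sym 2n≡)) (*-comm a (2 * n)))
  rhs : σ n + a * σ n ≡ σ n * (1 + a)
  rhs = trans (cong (σ n +_) (*-comm a (σ n))) (sym (*-suc (σ n) a))

cofactor-bound⇔ : ∀ n a t .{{_ : NonZero t}} → Deficient n →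
  ℕ→ℚ a ℚ.> ℕ→ℚ (σ n) ÷? (deficiency n ℚ.+ (ℕ→ℚ (2 * n) ÷? ℕ→ℚ t)) ⇔
  σ n * (1 + a) * t < 2 * n * a * (1 + t)
cofactor-bound⇔ n a t@(suc t′) n-def = begin
  ℕ→ℚ a ℚ.> bound                                           ≈⟨ ≃-<⇔ bound≃ (ℕ→ℚ-≃ a) ⟩
  σ n * t * 1 < a * (suc k * t + 2 * n)                     ≡⟨ cong (_< a * (suc k * t + 2 * n)) (*-identityʳ (σ n * t)) ⟩
  σ n * t < a * (suc k * t + 2 * n)                         ≈⟨ <⇔+-<+ (a * σ n * t) ⟩
  σ n * t + a * σ n * t < a * (suc k * t + 2 * n) + a * σ n * t ≡⟨ cong₂ _<_ lhs rhs ⟩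
  σ n * (1 + a) * t < 2 * n * a * (1 + t)                   ∎
  where
  open import Relation.Binary.Reasoning.Setoid (⇔-setoid 0ℓ)
  k : ℕ
  k = proj₁ (deficient⇒gap {n} n-def)
  2n≡ : 2 * n ≡ suc k + σ n
  2n≡ = proj₂ (deficient⇒gap {n} n-def)
  bound : ℚ
  bound = ℕ→ℚ (σ n) ÷? (deficiency n ℚ.+ (ℕ→ℚ (2 * n) ÷? ℕ→ℚ t))
  2n/t≃ : ℕ→ℚ (2 * n) ÷? ℕ→ℚ t ≃ 2 * n /1+ t′
  2n/t≃ = subst₂ (_≃_/1+_ _) (*-identityʳ (2 * n)) (+-identityʳ t′) (≃-÷? (ℕ→ℚ-≃ (2 * n)) (ℕ→ℚ-≃ t))
  denominator≃ : deficiency n ℚ.+ (ℕ→ℚ (2 * n) ÷? ℕ→ℚ t) ≃ suc k * t + 2 * n /1+ t′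
  denominator≃ = subst₂ (_≃_/1+_ _) (cong (suc k * t +_) (*-identityʳ (2 * n))) (+-identityʳ t′)
    (≃-+ (deficiency-≃ {n} 2n≡) 2n/t≃)
  bound≃ : bound ≃ σ n * t /1+ (t′ + k * t + 2 * n)
  bound≃ = subst (_≃_/1+_ bound (σ n * t)) (+-identityʳ _) (≃-÷? (ℕ→ℚ-≃ (σ n)) denominator≃)
  lhs : σ n * t + a * σ n * t ≡ σ n * (1 + a) * t
  lhs = factor (σ n) a t
    where
    factor : ∀ s a t → s * t + a * s * t ≡ s * (1 + a) * t
    factor = solve-∀
  rhs : a * (suc k * t + 2 * n) + a * σ n * t ≡ 2 * n * a * (1 + t)
  rhs = trans (factor a (suc k) (σ n) t (2 * n))
        (trans (cong (λ x → a * x * t + a * (2 * n)) (sym 2n≡)) (factor′ a (2 * n) t))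
    where
    factor : ∀ a d s t N → a * (d * t + N) + a * s * t ≡ a * (d + s) * t + a * N
    factor = solve-∀
    factor′ : ∀ a N t → a * N * t + a * N ≡ N * a * (1 + t)
    factor′ = solve-∀

module MultiplyingByPrime {m p α : ℕ} (p-prime : Prime p) (pᵅ∥m : p ^ α ∥ m) where

  private
    P A : ℕ
    P = σ (p ^ α)
    A = p * P
    instance
      p≢0 : NonZero p
      p≢0 = prime⇒nonZero p-prime
      P≢0 : NonZero P
      P≢0 = >-nonZero (σ-^-pos p-prime α)

  σ-m*p : σ (m * p) * P ≡ σ m * (1 + A)
  σ-m*p with ∥⇒cofactor {β = α} pᵅ∥m
  ... | u , m≡pᵅu , p∤u = begin
    σ (m * p) * P                 ≡⟨ cong (λ x → σ x * P) m*p≡pᵅ⁺¹u ⟩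
    σ (p ^ suc α * u) * P         ≡⟨ σ-^suc-ratio p-prime p∤u α ⟩
    σ (p ^ α * u) * σ (p ^ suc α) ≡⟨ cong₂ (λ x y → σ x * y) (sym m≡pᵅu) (σ-^suc p-prime α) ⟩
    σ m * (1 + A)                 ∎
    where
    open ≡-Reasoning
    m*p≡pᵅ⁺¹u : m * p ≡ p ^ suc α * u
    m*p≡pᵅ⁺¹u = trans (cong (_* p) m≡pᵅu) (rotate (p ^ α) u p)
      where
      rotate : ∀ x y z → x * y * z ≡ z * x * y
      rotate = solve-∀

  abundant-m*p⇔ : Abundant (m * p) ⇔ 2 * m * A < σ m * (1 + A)
  abundant-m*p⇔ = <⇔<-scaled P (reassoc m p P) σ-m*p
    where
    reassoc : ∀ x y z → 2 * (x * y) * z ≡ 2 * x * (y * z)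
    reassoc = solve-∀

  deficient-cofactor⇔ : ∀ {q} β N → Prime q → q ≢ p → q ^ suc β ∥ m → q * N ≡ m * p →
    Deficient N ⇔ σ m * (1 + A) * (q * σ (q ^ β)) < 2 * m * A * (1 + q * σ (q ^ β))
  deficient-cofactor⇔ {q} β N q-prime q≢p qᵝ⁺¹∥m q*N≡m*p with ∥⇒cofactor {β = suc β} qᵝ⁺¹∥m
  ... | v , m≡qᵝ⁺¹v , q∤v = <⇔<-scaled (q * S * P) σN-scaled 2N-scaled
    where
    S′ S : ℕ
    S′ = σ (q ^ β)
    S  = σ (q ^ suc β)
    instance
      q≢0 : NonZero q
      q≢0 = prime⇒nonZero q-prime
      S≢0 : NonZero S
      S≢0 = >-nonZero (σ-^-pos q-prime (suc β))
      qSP≢0 : NonZero (q * S * P)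
      qSP≢0 = m*n≢0 (q * S) P {{m*n≢0 q S}}
    q∤v*p : ¬ q ∣ v * p
    q∤v*p q∣vp with euclidsLemma v p q-prime q∣vp
    ... | inj₁ q∣v = q∤v q∣v
    ... | inj₂ q∣p = prime∤prime q-prime p-prime q≢p q∣p
    m*p≡qᵝ⁺¹vp : m * p ≡ q ^ suc β * (v * p)
    m*p≡qᵝ⁺¹vp = trans (cong (_* p) m≡qᵝ⁺¹v) (*-assoc (q ^ suc β) v p)
    N≡qᵝvp : N ≡ q ^ β * (v * p)
    N≡qᵝvp = *-cancelˡ-≡ N _ q (trans q*N≡m*p (trans m*p≡qᵝ⁺¹vp (*-assoc q (q ^ β) (v * p))))
    ratio : σ (m * p) * S′ ≡ σ N * S
    ratio = subst₂ (λ x y → σ x * S′ ≡ σ y * S) (sym m*p≡qᵝ⁺¹vp) (sym N≡qᵝvp) (σ-^suc-ratio q-prime q∤v*p β)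
    σN-scaled : σ N * (q * S * P) ≡ σ m * (1 + A) * (q * S′)
    σN-scaled = begin
      σ N * (q * S * P)       ≡⟨ shuffle (σ N) q S P ⟩
      σ N * S * (q * P)       ≡⟨ cong (_* (q * P)) ratio ⟨
      σ (m * p) * S′ * (q * P) ≡⟨ shuffle′ (σ (m * p)) S′ q P ⟩
      σ (m * p) * P * (q * S′) ≡⟨ cong (_* (q * S′)) σ-m*p ⟩
      σ m * (1 + A) * (q * S′) ∎
      where
      open ≡-Reasoning
      shuffle : ∀ x q s t → x * (q * s * t) ≡ x * s * (q * t)
      shuffle = solve-∀
      shuffle′ : ∀ x s q t → x * s * (q * t) ≡ x * t * (q * s)
      shuffle′ = solve-∀
    2N-scaled : 2 * N * (q * S * P) ≡ 2 * m * A * (1 + q * S′)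
    2N-scaled = begin
      2 * N * (q * S * P)     ≡⟨ shuffle N q S P ⟩
      2 * (q * N) * (P * S)   ≡⟨ cong (λ x → 2 * x * (P * S)) q*N≡m*p ⟩
      2 * (m * p) * (P * S)   ≡⟨ shuffle′ m p P S ⟩
      2 * m * A * S           ≡⟨ cong (2 * m * A *_) (σ-^suc q-prime β) ⟩
      2 * m * A * (1 + q * S′) ∎
      where
      open ≡-Reasoning
      shuffle : ∀ n q s t → 2 * n * (q * s * t) ≡ 2 * (q * n) * (t * s)
      shuffle = solve-∀
      shuffle′ : ∀ m p t s → 2 * (m * p) * (t * s) ≡ 2 * m * (p * t) * s
      shuffle′ = solve-∀

  AboveThreshold : ℕ → Set
  AboveThreshold t = ℕ→ℚ A ℚ.> ℕ→ℚ (σ m) ÷? (deficiency m ℚ.+ (ℕ→ℚ (2 * m) ÷? ℕ→ℚ t))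

  AboveThresholds : Set
  AboveThresholds = ∀ q β → Prime q → q ∣ m → q ^ β ∥ m → q ≢ p → AboveThreshold (σ (q ^ β) ∸ 1)

  module _ (m-def : Deficient m) where

    below-center⇔abundant : ℕ→ℚ A ℚ.< center m ⇔ Abundant (m * p)
    below-center⇔abundant = begin
      ℕ→ℚ A ℚ.< center m        ≈⟨ center-bound⇔ m A m-def ⟩
      2 * m * A < σ m * (1 + A) ≈⟨ abundant-m*p⇔ ⟨
      Abundant (m * p)          ∎
      where open import Relation.Binary.Reasoning.Setoid (⇔-setoid 0ℓ)

    above⇔cofactor-deficient : ∀ {q} β N → Prime q → q ≢ p → q ^ suc β ∥ m → q * N ≡ m * p →
      AboveThreshold (σ (q ^ suc β) ∸ 1) ⇔ Deficient N
    above⇔cofactor-deficient {q} β N q-prime q≢p qᵝ⁺¹∥m q*N≡m*p = begin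
      AboveThreshold (σ (q ^ suc β) ∸ 1)                 ≡⟨ cong (λ x → AboveThreshold (x ∸ 1)) (σ-^suc q-prime β) ⟩
      AboveThreshold T                                   ≈⟨ cofactor-bound⇔ m A T m-def ⟩
      σ m * (1 + A) * T < 2 * m * A * (1 + T)            ≈⟨ deficient-cofactor⇔ β N q-prime q≢p qᵝ⁺¹∥m q*N≡m*p ⟨
      Deficient N                                        ∎
      where
      open import Relation.Binary.Reasoning.Setoid (⇔-setoid 0ℓ)
      T : ℕ
      T = q * σ (q ^ β)
      instance
        T≢0 : NonZero T
        T≢0 = m*n≢0 q (σ (q ^ β)) {{prime⇒nonZero q-prime}} {{>-nonZero (σ-^-pos q-prime β)}}

    0<m*p : 0 < m * p
    0<m*p = <-≤-trans (deficient⇒pos m-def) (m≤m*n m p)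

    proper-deficient⇒above : (∀ d → ProperDivisor d (m * p) → Deficient d) → AboveThresholds
    proper-deficient⇒above proper-def q zero    _       q∣m        q⁰∥m   _   = contradiction q⁰∥m (∣⇒¬^0∥ q∣m)
    proper-deficient⇒above proper-def q (suc β) q-prime (divides k m≡kq) qᵝ⁺¹∥m q≢p =
      from (above⇔cofactor-deficient β (k * p) q-prime q≢p qᵝ⁺¹∥m q*kp≡m*p)
           (proper-def (k * p) (cofactor-properDivisor q-prime 0<m*p q*kp≡m*p))
      where
      q*kp≡m*p : q * (k * p) ≡ m * p
      q*kp≡m*p = trans (sym (*-assoc q k p)) (cong (_* p) (trans (*-comm q k) (sym m≡kq)))

    above⇒cofactor-deficient : AboveThresholds → ∀ {q} N → Prime q → q * N ≡ m * p → Deficient N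
    above⇒cofactor-deficient above {q} N q-prime q*N≡m*p = by-cases (q ≟ p)
      where
      by-cases : Dec (q ≡ p) → Deficient N
      by-cases (yes refl) = subst Deficient (sym (*-cancelˡ-≡ N m p (trans q*N≡m*p (*-comm m p)))) m-def
      by-cases (no q≢p)   = via (∣⇒∃^suc∥ q-prime (deficient⇒pos m-def) q∣m)
        where
        q∣m : q ∣ m
        q∣m = prime∣m*p⇒∣m q-prime p-prime q≢p (divides N (trans (sym q*N≡m*p) (*-comm q N)))
        via : ∃[ β ] q ^ suc β ∥ m → Deficient N
        via (β , qᵝ⁺¹∥m) = to (above⇔cofactor-deficient β N q-prime q≢p qᵝ⁺¹∥m q*N≡m*p)
                              (above q (suc β) q-prime q∣m qᵝ⁺¹∥m q≢p)

    above⇒proper-deficient : AboveThresholds → ∀ d → ProperDivisor d (m * p) → Deficient d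
    above⇒proper-deficient above d d-proper = via (properDivisor⇒∣-prime-cofactor d-proper)
      where
      via : (∃₂ λ q N → Prime q × q * N ≡ m * p × d ∣ N) → Deficient d
      via (q , N , q-prime , q*N≡m*p , d∣N) = deficient-∣ d∣N (above⇒cofactor-deficient above N q-prime q*N≡m*p)

theorem2p14 : (m p α : ℕ) → Deficient m → Prime p → p ∣ m → p ^ α ∥ m →
    PrimitiveAbundant (m * p) ⇔
      ( (ℕ→ℚ (p * σ (p Data.Nat.^ α)) Data.Rational.< center m)
      × (∀ (q β : ℕ) → Prime q → q ∣ m → q ^ β ∥ m → q ≢ p →
          ℕ→ℚ (p * σ (p Data.Nat.^ α)) Data.Rational.>
            (ℕ→ℚ (σ m) ÷? (deficiency m Data.Rational.+ (ℕ→ℚ (2 * m) ÷? ℕ→ℚ (σ (q Data.Nat.^ β) ∸ 1))))) )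
theorem2p14 m p α m-def p-prime _ pᵅ∥m = mk⇔ forward backward
  where
  open MultiplyingByPrime {α = α} p-prime pᵅ∥m
  forward : PrimitiveAbundant (m * p) → ℕ→ℚ (p * σ (p ^ α)) ℚ.< center m × AboveThresholds
  forward ((_ , proper-def) , abundant) =
    from (below-center⇔abundant m-def) abundant , proper-deficient⇒above m-def proper-def
  backward : ℕ→ℚ (p * σ (p ^ α)) ℚ.< center m × AboveThresholds → PrimitiveAbundant (m * p)
  backward (below-center , above) = (<⇒≤ abundant , above⇒proper-deficient m-def above) , abundant
    where
    abundant : Abundant (m * p)
    abundant = to (below-center⇔abundant m-def) below-center
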